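{- Let $G$ be an infinite connected bipartite graph with sides $A$ and $B$. If $G$ is a dHp graph, then $G$ is not locally finite (i.e. some vertex of $G$ has infinite degree).
   Context: For $X\subseteq V(G)$ with $|X|\ge 2$, $N^2(X)$ denotes the set of vertices of $G$ having at least two neighbours in $X$. A bipartite graph $G$ with sides $A$ and $B$ is a dHp graph if $|A|\ge 2$ and $|N^2(X)|\ge |X|$ for every $X\subseteq A$ with $|X|\ge 2$. -}

module Defs where

open import Level using (0ℓ)
open import Data.Empty using (⊥)
open import Data.Sum using (_⊎_; inj₁; inj₂)
open import Data.Product using (Σ; _×_; _,_; proj₁; ∃; ∃-syntax)
open import Data.List using (List)
open import Data.List.Membership.Propositional using (_∈_)
open import Relation.Nullary using (¬_)
open import Relation.Binary.PropositionalEquality using (_≡_; _≢_)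
open import Relation.Binary.Construct.Closure.ReflexiveTransitive using (Star)

-- All notions below only
-- look at *which* vertices are adjacent (never at edge proofs), so the
-- graph is effectively simple.
record BipGraph : Set₁ where
  field
    A : Set
    B : Set
    E : A → B → Set

module _ (G : BipGraph) where
  open BipGraph G

  Vertex : Set
  Vertex = A ⊎ B

  Adj : Vertex → Vertex → Set
  Adj (inj₁ a) (inj₂ b) = E a b
  Adj (inj₂ b) (inj₁ a) = E a b
  Adj _        _        = ⊥

  Connected : Set
  Connected = ∀ (u v : Vertex) → Star Adj u v

  FiniteSub : {X : Set} → (X → Set) → Set
  FiniteSub {X} P = ∃[ xs ] (∀ (x : X) → P x → x ∈ xs)

  Infinite : Set
  Infinite = ¬ FiniteSub {Vertex} (λ _ → Vertex)

  LocallyFinite : Set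
  LocallyFinite = ∀ (v : Vertex) → FiniteSub (Adj v)

  AtLeastTwo : (A → Set) → Set
  AtLeastTwo X = ∃[ a ] ∃[ a' ] (a ≢ a' × X a × X a')

  N² : (A → Set) → B → Set
  N² X b = ∃[ a ] ∃[ a' ] (a ≢ a' × X a × X a' × E a b × E a' b)

  -- |N²(X)| ≥ |X|: an injection from X into N²(X) (injective on the
  -- underlying vertices)
  CardGe : (A → Set) → Set
  CardGe X = Σ (Σ A X → Σ B (N² X)) λ f →
    ∀ x y → proj₁ (f x) ≡ proj₁ (f y) → proj₁ x ≡ proj₁ y

  IsDHP : Set₁
  IsDHP = (Σ A λ a → Σ A λ a' → a ≢ a') ×
          (∀ (X : A → Set) → AtLeastTwo X → CardGe X)

-- By the dHp condition for X = {a₀, y}, every y ∈ A has a common neighbour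
-- with a fixed a₀ ∈ A, and by connectivity every b ∈ B has a neighbour in A.
-- So every vertex lies in the ball of radius 3 around a₀, which is finite when
-- G is locally finite; hence G would be finite.  Equality on A is not
-- decidable, so "y = a₀ or y ≠ a₀" is only available under double negation,
-- which is harmless because the goal is a negation.
module Submission where

open import Level using (0ℓ)
open import Data.Empty using (⊥-elim)
open import Data.Nat using (ℕ; zero; suc)
open import Data.Sum using (_⊎_; inj₁; inj₂)
open import Data.Product using (_×_; _,_; proj₁; proj₂; ∃-syntax)
open import Data.List using (List; []; _∷_; _++_; concatMap)
open import Data.List.Membership.Propositional using (_∈_; lose)
open import Data.List.Membership.Propositional.Properties
  using (∈-++⁺ˡ; ∈-++⁺ʳ; ∈-concatMap⁺)
open import Data.List.Relation.Unary.Any using (here)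
open import Data.List.Relation.Unary.All as All using (All)
open import Relation.Nullary using (¬_)
open import Relation.Nullary.Negation using (¬¬-Monad; ¬¬-map)
open import Relation.Binary.PropositionalEquality using (_≡_; refl; _≢_)
open import Relation.Binary.Construct.Closure.ReflexiveTransitive using (Star; ε; _◅_)

open import Defs

module FiniteNeighbourhoods {V : Set} (R : V → V → Set) (nbrs : V → List V)
                            (nbrs-complete : ∀ {u v} → R u v → v ∈ nbrs u) where

  neighbours : List V → List V
  neighbours = concatMap nbrs

  ∈-neighbours : ∀ {xs u v} → u ∈ xs → R u v → v ∈ neighbours xs
  ∈-neighbours u∈xs uRv = ∈-concatMap⁺ nbrs (lose u∈xs (nbrs-complete uRv))

  ball : ℕ → V → List V
  ball zero    v = v ∷ []
  ball (suc n) v = ball n v ++ neighbours (ball n v)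

  centre∈ball : ∀ n v → v ∈ ball n v
  centre∈ball zero    v = here refl
  centre∈ball (suc n) v = ∈-++⁺ˡ (centre∈ball n v)

  ball-⊆-suc : ∀ n {v u} → u ∈ ball n v → u ∈ ball (suc n) v
  ball-⊆-suc n = ∈-++⁺ˡ

  ∈-ball-step : ∀ n {v u w} → u ∈ ball n v → R u w → w ∈ ball (suc n) v
  ∈-ball-step n {v} u∈ball uRw = ∈-++⁺ʳ (ball n v) (∈-neighbours u∈ball uRw)

  Star-closed : ∀ {K} → All (_∈ K) (neighbours K) →
                ∀ {u v} → u ∈ K → Star R u v → v ∈ K
  Star-closed closed u∈K ε           = u∈K
  Star-closed closed u∈K (uRw ◅ w⇝v) =
    Star-closed closed (All.lookup closed (∈-neighbours u∈K uRw)) w⇝v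

  -- "∀ v → v ∈ K" does not follow from "∀ v → ¬ ¬ v ∈ K" constructively, but
  -- closedness of K only quantifies over the finite list neighbours K, where
  -- the double negations can be collected; reachability then does the rest.
  ¬¬-covers : ∀ {K v₀} → (∀ v → Star R v₀ v) → v₀ ∈ K →
              (∀ v → ¬ ¬ v ∈ K) → ¬ ¬ (∀ v → v ∈ K)
  ¬¬-covers reach v₀∈K ¬¬∈K =
    ¬¬-map (λ closed v → Star-closed closed v₀∈K (reach v))
           (All.sequenceM 0ℓ ¬¬-Monad (All.universal ¬¬∈K _))

module _ (G : BipGraph) where
  open BipGraph G

  Pair : A → A → A → Set
  Pair a a' x = x ≡ a ⊎ x ≡ a'

  N²-Pair : ∀ {a a' b} → N² G (Pair a a') b → E a b × E a' b
  N²-Pair (_ , _ , x≢x , inj₁ refl , inj₁ refl , _)   = ⊥-elim (x≢x refl)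
  N²-Pair (_ , _ , _   , inj₁ refl , inj₂ refl , e , e') = e , e'
  N²-Pair (_ , _ , _   , inj₂ refl , inj₁ refl , e , e') = e' , e
  N²-Pair (_ , _ , x≢x , inj₂ refl , inj₂ refl , _)   = ⊥-elim (x≢x refl)

  common-neighbour : IsDHP G → ∀ {a a'} → a ≢ a' → ∃[ b ] (E a b × E a' b)
  common-neighbour (_ , dhp) {a} {a'} a≢a' =
    let (b , b∈N²) = proj₁ (dhp (Pair a a') (a , a' , a≢a' , inj₁ refl , inj₂ refl))
                           (a , inj₁ refl)
    in b , N²-Pair b∈N²

  B-has-neighbour : Connected G → A → ∀ b → ∃[ a ] E a b
  B-has-neighbour con a₀ b with con (inj₂ b) (inj₁ a₀)
  ... | _◅_ {j = inj₁ a} e _ = a , e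

  module _ (lf : LocallyFinite G) where
    open FiniteNeighbourhoods (Adj G) (λ v → proj₁ (lf v)) (λ {u} {v} → proj₂ (lf u) v)

    ¬¬-A∈ball₂ : IsDHP G → ∀ a₀ y → ¬ ¬ inj₁ y ∈ ball 2 (inj₁ a₀)
    ¬¬-A∈ball₂ dhp a₀ y y∉ball =
      let (b , e₀ , e) = common-neighbour dhp {a₀} {y} λ { refl → y∉ball (centre∈ball 2 _) }
      in y∉ball (∈-ball-step 1 (∈-ball-step 0 {w = inj₂ b} (centre∈ball 0 _) e₀) e)

    ¬¬-∈ball₃ : Connected G → IsDHP G → ∀ a₀ v → ¬ ¬ v ∈ ball 3 (inj₁ a₀)
    ¬¬-∈ball₃ con dhp a₀ (inj₁ y) = ¬¬-map (ball-⊆-suc 2) (¬¬-A∈ball₂ dhp a₀ y)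
    ¬¬-∈ball₃ con dhp a₀ (inj₂ b) =
      let (y , e) = B-has-neighbour con a₀ b
      in ¬¬-map (λ y∈ball → ∈-ball-step 2 y∈ball e) (¬¬-A∈ball₂ dhp a₀ y)

    ¬¬-finite : Connected G → IsDHP G → ¬ ¬ FiniteSub G (λ _ → Vertex G)
    ¬¬-finite con dhp =
      ¬¬-map (λ covers → ball 3 (inj₁ a₀) , λ v _ → covers v)
             (¬¬-covers (con (inj₁ a₀)) (centre∈ball 3 _) (¬¬-∈ball₃ con dhp a₀))
      where
        a₀ : A
        a₀ = proj₁ (proj₁ dhp)

proposition2p1 : (G : BipGraph) → Infinite G → Connected G → IsDHP G →
    ¬ LocallyFinite G
proposition2p1 G inf con dhp lf = ¬¬-finite G lf con dhp inf
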